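{- Let $G=(V,E)$ be a graph satisfying the standing assumptions and let $u,v\in V$ with $\tau(u)=\tau(v)=3$. If one of the following holds: (1) $\gamma_u$ is not a prefix of $\gamma_v$ and $\gamma_u\prec\gamma_v$; (2) $\gamma_u=\gamma_v$, $\mathtt{t}_u=2$ and $\mathtt{t}_v=3$; (3) $\gamma_v$ is a strict prefix of $\gamma_u$ — then $\min_u\prec\min_v$. Equivalently, if $\min_u\preceq\min_v$, then one of the following holds: (i) $\gamma_u$ is not a prefix of $\gamma_v$ and $\gamma_u\prec\gamma_v$; (ii) $\gamma_u=\gamma_v$ and $\mathtt{t}_u\le\mathtt{t}_v$; (iii) $\gamma_v$ is a strict prefix of $\gamma_u$.
   Context: Standing assumptions: $\Sigma$ is a finite alphabet with a total order $\preceq$, extended lexicographically to finite and right-infinite strings; $G=(V,E)$ is finite, $E\subseteq V\times V\times\Sigma$, every node has an incoming edge, all edges entering a node $u$ have the same label $\lambda(u)$ (edges are written $(u,v)$), and $G$ is deterministic. An occurrence of $\alpha\in\Sigma^\omega$ starting at $u$ is a sequence $(u_i)_{i\ge1}$ with $u_1=u$, $(u_{i+1},u_i)\in E$, $\lambda(u_i)=\alpha[i]$; $\min_u$ is the lexicographically smallest string in $\Sigma^\omega$ with an occurrence starting at $u$; $\alpha[i,j]=\alpha[i]\cdots\alpha[j]$. For $\alpha=a\alpha'$: $\tau(\alpha)=1$ if $\alpha'\prec\alpha$, $2$ if $\alpha'=\alpha$, $3$ if $\alpha\prec\alpha'$; $\tau(u):=\tau(\min_u)$. For $\tau(u)=3$,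 $\ell_u$ is the smallest $k\ge2$ with $\tau(u_k)\ge2$ for an (any) occurrence $(u_i)$ of $\min_u$ starting at $u$. For nonempty $R\subseteq V$, $R'=\arg\min_{v\in R}\lambda(v)$, $\mathtt{F}(R)=\arg\min_{v\in R'}\tau(v)$. $G_1(u)=\{u\}$, and for $1<i\le\ell_u$, $G_i(u)=\mathtt{F}(\{v':\exists v\in G_{i-1}(u),(v',v)\in E\})\setminus\bigcup_{j=2}^{i-1}G_j(u)$. Define $\gamma_u=\min_u[1,\ell_u]$ and $\mathtt{t}_u\in\{2,3\}$ as the common value of $\tau$ on the nodes of $G_{\ell_u}(u)$. -}

module Defs where

open import Data.Nat using (ℕ; zero; suc; _≤_; _<_; _∸_)
open import Data.Fin using (Fin)
import Data.Fin as F
open import Data.Bool using (Bool; true)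
open import Data.List using (List; applyUpTo)
open import Data.Product using (Σ; ∃; _×_; _,_; proj₁; proj₂)
open import Data.Sum using (_⊎_)
open import Data.Empty using (⊥)
open import Data.Unit using (⊤)
open import Relation.Nullary using (¬_)
open import Relation.Binary.PropositionalEquality using (_≡_)

-- Alphabet: Σ = Fin σ with its natural total order (any finite totally
-- ordered alphabet is order-isomorphic to one of these).

-- Right-infinite strings, 0-indexed: α i is the paper's α[i+1].
Str : ℕ → Set
Str σ = ℕ → Fin σ

tail : ∀ {σ} → Str σ → Str σ
tail α i = α (suc i)

_≐_ : ∀ {σ} → Str σ → Str σ → Set
α ≐ β = ∀ i → α i ≡ β i

_≺_ : ∀ {σ} → Str σ → Str σ → Set
α ≺ β = ∃ λ k → (∀ i → i < k → α i ≡ β i) × (α k F.< β k)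

_≼_ : ∀ {σ} → Str σ → Str σ → Set
α ≼ β = (α ≺ β) ⊎ (α ≐ β)

τ : ∀ {σ} → Str σ → ℕ → Set
τ α 1 = tail α ≺ α
τ α 2 = tail α ≐ α
τ α 3 = α ≺ tail α
τ α _ = ⊥

pre : ∀ {σ} → Str σ → ℕ → List (Fin σ)
pre α k = applyUpTo α k

-- Graphs: nodes Fin n; E u v = true means the edge (u,v) ∈ E; the label
-- of every edge entering v is lab v (= λ(v)).

record Graph (σ n : ℕ) : Set where
  field
    E   : Fin n → Fin n → Bool
    lab : Fin n → Fin σ
open Graph public

EveryNodeHasIncoming : ∀ {σ n} → Graph σ n → Set
EveryNodeHasIncoming G = ∀ v → ∃ λ u → E G u v ≡ true

Deterministic : ∀ {σ n} → Graph σ n → Set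
Deterministic G = ∀ u v w → E G u v ≡ true → E G u w ≡ true →
                  lab G v ≡ lab G w → v ≡ w

-- (us i)_{i} is an occurrence of α starting at u (us i = paper's u_{i+1})
Occ : ∀ {σ n} → Graph σ n → Str σ → Fin n → (ℕ → Fin n) → Set
Occ G α u us = (us 0 ≡ u)
             × (∀ i → E G (us (suc i)) (us i) ≡ true)
             × (∀ i → lab G (us i) ≡ α i)

IsMin : ∀ {σ n} → Graph σ n → Fin n → Str σ → Set
IsMin G u α = (∃ λ us → Occ G α u us)
            × (∀ β us → Occ G β u us → α ≼ β)

module _ {σ n} (G : Graph σ n) (mn : Fin n → Str σ) where
  -- mn u is min_u (assumed to satisfy IsMin); τ(u) := τ(min_u)
  τN : Fin n → ℕ → Set
  τN u t = τ (mn u) t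

  τ≥2 : Fin n → Set
  τ≥2 u = τN u 2 ⊎ τN u 3

  IsEll : Fin n → ℕ → Set
  IsEll u ℓ = Σ (ℕ → Fin n) λ us → Occ G (mn u) u us
            × (2 ≤ ℓ)
            × τ≥2 (us (ℓ ∸ 1))
            × (∀ k → 2 ≤ k → k < ℓ → ¬ τ≥2 (us (k ∸ 1)))

  ArgMinλ : (Fin n → Set) → Fin n → Set
  ArgMinλ R v = R v × (∀ w → R w → lab G v F.≤ lab G w)

  Fset : (Fin n → Set) → Fin n → Set
  Fset R v = ArgMinλ R v
           × ∃ λ t → τN v t × (∀ w t′ → ArgMinλ R w → τN w t′ → t ≤ t′)

  Preds : (Fin n → Set) → Fin n → Set
  Preds C v′ = ∃ λ v → C v × E G v′ v ≡ true

  -- H i = (G_i(u) , ⋃_{j=2}^{i} G_j(u))  for i ≥ 1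
  H : Fin n → ℕ → (Fin n → Set) × (Fin n → Set)
  H u zero = (λ _ → ⊥) , (λ _ → ⊥)
  H u (suc zero) = (λ x → x ≡ u) , (λ _ → ⊥)
  H u (suc (suc i)) = step (proj₁ (H u (suc i))) (proj₂ (H u (suc i)))
    where
    step : (Fin n → Set) → (Fin n → Set) → (Fin n → Set) × (Fin n → Set)
    step C U = (λ x → Fset (Preds C) x × ¬ U x)
             , (λ x → U x ⊎ (Fset (Preds C) x × ¬ U x))

  Gset : Fin n → ℕ → Fin n → Set
  Gset u i = proj₁ (H u i)

  IsT : Fin n → ℕ → ℕ → Set
  IsT u ℓ t = (∃ λ x → Gset u ℓ x) × (∀ x → Gset u ℓ x → τN x t)

module Submission where

-- Write α = min_u and let (u_i) be an occurrence of α. Then min_{u_i} is the suffix of α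
-- starting at position i, so the suffixes at positions 2, …, ℓ_u decrease strictly; this keeps
-- the greedy sets on the occurrence (u_i ∈ G_i(u)) and gives t_u = τ(u_{ℓ_u}). Among strings
-- with a common first letter c, type 1 lies below c^ω, type 2 equals it and type 3 lies above
-- it. So when γ_u and γ_v agree up to position i, min_u and min_v compare as τ(u_i) and τ(v_i):
-- in case (2) at i = ℓ_u = ℓ_v, in case (3) at i = ℓ_v, where τ(u_i) = 1 but τ(v_i) ≥ 2. The
-- converse holds because the three conditions, with u and v swapped, cover every comparison of
-- γ_u with γ_v. Constructively, τ is decidable on minimal strings because they are ultimately
-- periodic.

open import Defs
open import Data.Nat using (ℕ; zero; suc; _+_; _∸_; z≤n; s≤s; _≤_; _<_)
import Data.Nat.Properties as ℕ
open import Data.Nat.Induction using (<-rec)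
open import Data.Fin using (Fin)
import Data.Fin as F
import Data.Fin.Properties as FP
open import Data.Bool using (true)
open import Data.List using (List; _∷_)
open import Data.List.Relation.Binary.Lex.Strict using (Lex-<; this; next; <-compare)
open import Data.List.Relation.Binary.Prefix.Heterogeneous using (Prefix; []; _∷_)
open import Data.List.Relation.Binary.Prefix.Heterogeneous.Properties using (prefix?; fromPointwise)
open import Data.List.Relation.Binary.Pointwise using (Pointwise-≡⇒≡; ≡⇒Pointwise-≡)
open import Data.Product using (∃; ∃₂; _×_; _,_; proj₁; proj₂)
open import Data.Sum using (_⊎_; inj₁; inj₂)
open import Function using (_∘_; const)
open import Relation.Nullary using (¬_; yes; no; contradiction)
open import Relation.Binary.Definitions using (tri<; tri≈; tri>)
open import Relation.Binary.PropositionalEquality using (_≡_; _≢_; refl; sym; trans; cong; subst; subst₂; cong₂; module ≡-Reasoning)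

module _ {σ : ℕ} where

  Agree : Str σ → Str σ → ℕ → Set
  Agree α β k = ∀ i → i < k → α i ≡ β i

  drop : ℕ → Str σ → Str σ
  drop k α i = α (k + i)

  drop-head : ∀ k (α : Str σ) → drop k α 0 ≡ α k
  drop-head k α = cong α (ℕ.+-identityʳ k)

  tail-drop : ∀ k (α : Str σ) → tail (drop k α) ≐ drop (suc k) α
  tail-drop k α i = cong α (ℕ.+-suc k i)

  Agree-tail : ∀ {α β : Str σ} {k} → Agree α β (suc k) → Agree (tail α) (tail β) k
  Agree-tail ag i i<k = ag (suc i) (s≤s i<k)

  Agree-cons : ∀ {α β : Str σ} {k} → α 0 ≡ β 0 → Agree (tail α) (tail β) k → Agree α β (suc k)
  Agree-cons e ag zero _ = e
  Agree-cons e ag (suc i) i<k = ag i (ℕ.≤-pred i<k)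

  ≐-refl : {α : Str σ} → α ≐ α
  ≐-refl i = refl

  ≐-sym : {α β : Str σ} → α ≐ β → β ≐ α
  ≐-sym p i = sym (p i)

  ≐-trans : {α β γ : Str σ} → α ≐ β → β ≐ γ → α ≐ γ
  ≐-trans p q i = trans (p i) (q i)

  ≺-irrefl : {α : Str σ} → ¬ α ≺ α
  ≺-irrefl (_ , _ , lt) = ℕ.<-irrefl refl lt

  ≺-resp-≐ : {α α′ β β′ : Str σ} → α ≐ α′ → β ≐ β′ → α ≺ β → α′ ≺ β′
  ≺-resp-≐ p q (k , ag , lt) =
    k , (λ i i<k → trans (sym (p i)) (trans (ag i i<k) (q i))) ,
    subst₂ F._<_ (p k) (q k) lt

  ≺-trans : {α β γ : Str σ} → α ≺ β → β ≺ γ → α ≺ γ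
  ≺-trans {α = α} {γ = γ} (k , ag , lt) (k′ , ag′ , lt′) with ℕ.<-cmp k k′
  ... | tri< k<k′ _ _ = k , (λ i i<k → trans (ag i i<k) (ag′ i (ℕ.<-trans i<k k<k′))) ,
                        subst (α k F.<_) (ag′ k k<k′) lt
  ... | tri≈ _ refl _ = k , (λ i i<k → trans (ag i i<k) (ag′ i i<k)) , ℕ.<-trans lt lt′
  ... | tri> _ _ k′<k = k′ , (λ i i<k′ → trans (ag i (ℕ.<-trans i<k′ k′<k)) (ag′ i i<k′)) ,
                        subst (F._< γ k′) (sym (ag k′ k′<k)) lt′

  ≺-≼-trans : {α β γ : Str σ} → α ≺ β → β ≼ γ → α ≺ γ
  ≺-≼-trans p (inj₁ q) = ≺-trans p q
  ≺-≼-trans p (inj₂ q) = ≺-resp-≐ ≐-refl q p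

  ≼-≺-trans : {α β γ : Str σ} → α ≼ β → β ≺ γ → α ≺ γ
  ≼-≺-trans (inj₁ p) q = ≺-trans p q
  ≼-≺-trans (inj₂ p) q = ≺-resp-≐ (≐-sym p) ≐-refl q

  ≼-trans : {α β γ : Str σ} → α ≼ β → β ≼ γ → α ≼ γ
  ≼-trans (inj₁ p) q = inj₁ (≺-≼-trans p q)
  ≼-trans (inj₂ p) (inj₁ q) = inj₁ (≼-≺-trans (inj₂ p) q)
  ≼-trans (inj₂ p) (inj₂ q) = inj₂ (≐-trans p q)

  ≺⇒⋡ : {α β : Str σ} → α ≺ β → ¬ β ≼ α
  ≺⇒⋡ p q = ≺-irrefl (≺-≼-trans p q)

  ≼-antisym : {α β : Str σ} → α ≼ β → β ≼ α → α ≐ β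
  ≼-antisym (inj₁ p) q = contradiction q (≺⇒⋡ p)
  ≼-antisym (inj₂ p) _ = p

  ≼⇒head-≤ : {α β : Str σ} → α ≼ β → α 0 F.≤ β 0
  ≼⇒head-≤ (inj₁ (zero , _ , lt)) = ℕ.<⇒≤ lt
  ≼⇒head-≤ (inj₁ (suc _ , ag , _)) = ℕ.≤-reflexive (cong F.toℕ (ag 0 (s≤s z≤n)))
  ≼⇒head-≤ (inj₂ p) = ℕ.≤-reflexive (cong F.toℕ (p 0))

  ≼-tail : {α β : Str σ} → α ≼ β → α 0 ≡ β 0 → tail α ≼ tail β
  ≼-tail (inj₁ (zero , _ , lt)) e = contradiction (cong F.toℕ e) (ℕ.<⇒≢ lt)
  ≼-tail (inj₁ (suc k , ag , lt)) e = inj₁ (k , Agree-tail ag , lt)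
  ≼-tail (inj₂ p) e = inj₂ (λ i → p (suc i))

  ≺-tail⁻ : {α β : Str σ} → α 0 ≡ β 0 → tail α ≺ tail β → α ≺ β
  ≺-tail⁻ e (k , ag , lt) = suc k , Agree-cons e ag , lt

  ≼-drop : ∀ L {α β : Str σ} → Agree α β L → α ≼ β → drop L α ≼ drop L β
  ≼-drop zero _ le = le
  ≼-drop (suc L) ag le = ≼-drop L (Agree-tail ag) (≼-tail le (ag 0 (s≤s z≤n)))

  ≺-drop⁻ : ∀ L {α β : Str σ} → Agree α β L → drop L α ≺ drop L β → α ≺ β
  ≺-drop⁻ zero _ lt = lt
  ≺-drop⁻ (suc L) ag lt = ≺-tail⁻ (ag 0 (s≤s z≤n)) (≺-drop⁻ L (Agree-tail ag) lt)

  τ-resp-≐ : ∀ {α β : Str σ} t → α ≐ β → τ α t → τ β t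
  τ-resp-≐ 1 p q = ≺-resp-≐ (λ i → p (suc i)) p q
  τ-resp-≐ 2 p q = ≐-trans (≐-sym (λ i → p (suc i))) (≐-trans q p)
  τ-resp-≐ 3 p q = ≺-resp-≐ p (λ i → p (suc i)) q
  τ-resp-≐ 0 _ ()
  τ-resp-≐ (suc (suc (suc (suc _)))) _ ()

  run-head : ∀ {α : Str σ} k → (∀ i → i < k → α (suc i) ≡ α i) → ∀ i → i ≤ k → α i ≡ α 0
  run-head k step zero _ = refl
  run-head k step (suc i) i<k = trans (step i i<k) (run-head k step i (ℕ.<⇒≤ i<k))

  τ₁⇒≺const : {α : Str σ} → τ α 1 → α ≺ const (α 0)
  τ₁⇒≺const {α} (k , ag , lt) =
    suc k , (λ i i<k → run-head k ag i (ℕ.≤-pred i<k)) , subst (α (suc k) F.<_) (run-head k ag k ℕ.≤-refl) lt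

  τ₂⇒≐const : {α : Str σ} → τ α 2 → α ≐ const (α 0)
  τ₂⇒≐const p zero = refl
  τ₂⇒≐const p (suc i) = trans (p i) (τ₂⇒≐const p i)

  τ₃⇒const≺ : {α : Str σ} → τ α 3 → const (α 0) ≺ α
  τ₃⇒const≺ {α} (k , ag , lt) =
    suc k , (λ i i<k → sym (run-head k ascent i (ℕ.≤-pred i<k))) ,
    subst (F._< α (suc k)) (run-head k ascent k ℕ.≤-refl) lt
    where
    ascent : ∀ i → i < k → α (suc i) ≡ α i
    ascent i i<k = sym (ag i i<k)

  τ-strict : ∀ {α β : Str σ} t t′ → α 0 ≡ β 0 → τ α t → τ β t′ → t < t′ → α ≺ β
  τ-strict 0 _ _ () _ _
  τ-strict _ 0 _ _ () _
  τ-strict _ (suc (suc (suc (suc _)))) _ _ () _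
  τ-strict 1 2 e p q _ = ≺-resp-≐ ≐-refl (≐-trans (λ _ → e) (≐-sym (τ₂⇒≐const q))) (τ₁⇒≺const p)
  τ-strict 1 3 e p q _ = ≺-trans (τ₁⇒≺const p) (≺-resp-≐ (λ _ → sym e) ≐-refl (τ₃⇒const≺ q))
  τ-strict 2 3 e p q _ = ≺-resp-≐ (≐-trans (λ _ → sym e) (≐-sym (τ₂⇒≐const p))) ≐-refl (τ₃⇒const≺ q)
  τ-strict (suc _) 1 _ _ _ (s≤s ())
  τ-strict (suc (suc _)) 2 _ _ _ (s≤s (s≤s ()))
  τ-strict (suc (suc (suc _))) 3 _ _ _ (s≤s (s≤s (s≤s ())))

  τ-mono : ∀ {α β : Str σ} {t t′} → α ≼ β → α 0 ≡ β 0 → τ α t → τ β t′ → t ≤ t′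
  τ-mono {t = t} {t′} le e p q with t ℕ.≤? t′
  ... | yes t≤t′ = t≤t′
  ... | no t≰t′ = contradiction le (≺⇒⋡ (τ-strict t′ t (sym e) q p (ℕ.≰⇒> t≰t′)))

  Agree⇒drop-head : ∀ {α β : Str σ} L → Agree α β (suc L) → drop L α 0 ≡ drop L β 0
  Agree⇒drop-head {α} {β} L ag = begin
    drop L α 0  ≡⟨ drop-head L α ⟩
    α L         ≡⟨ ag L ℕ.≤-refl ⟩
    β L         ≡⟨ drop-head L β ⟨
    drop L β 0  ∎
    where open ≡-Reasoning

  ≺-by-τ-at : ∀ {α β : Str σ} L {t t′} → Agree α β (suc L) →
              τ (drop L α) t → τ (drop L β) t′ → t < t′ → α ≺ β
  ≺-by-τ-at L ag p q t<t′ =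
    ≺-drop⁻ L (λ i → ag i ∘ ℕ.m<n⇒m<1+n) (τ-strict _ _ (Agree⇒drop-head L ag) p q t<t′)

  τ-at-mono : ∀ {α β : Str σ} L {t t′} → α ≼ β → Agree α β (suc L) →
              τ (drop L α) t → τ (drop L β) t′ → t ≤ t′
  τ-at-mono L le ag = τ-mono (≼-drop L (λ i → ag i ∘ ℕ.m<n⇒m<1+n) le) (Agree⇒drop-head L ag)

  Periodic : Str σ → ℕ → ℕ → Set
  Periodic α N q = ∀ m → N ≤ m → α (m + q) ≡ α m

  Periodic-tail : ∀ {α : Str σ} {N q} → Periodic α N q → Periodic (tail α) N q
  Periodic-tail per m N≤m = per (suc m) (ℕ.m≤n⇒m≤1+n N≤m)

  drop-≐⇒Periodic : ∀ {α : Str σ} N q → drop N α ≐ drop (N + q) α → Periodic α N q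
  drop-≐⇒Periodic {α} N q eq m N≤m = begin
    α (m + q)        ≡⟨ cong (α ∘ (_+ q)) m≡N+d ⟩
    α (N + d + q)    ≡⟨ cong α (ℕ.+-assoc N d q) ⟩
    α (N + (d + q))  ≡⟨ cong (α ∘ (N +_)) (ℕ.+-comm d q) ⟩
    α (N + (q + d))  ≡⟨ cong α (ℕ.+-assoc N q d) ⟨
    α (N + q + d)    ≡⟨ eq d ⟨
    α (N + d)        ≡⟨ cong α m≡N+d ⟨
    α m              ∎
    where
    open ≡-Reasoning
    d : ℕ
    d = m ∸ N
    m≡N+d : m ≡ N + d
    m≡N+d = sym (ℕ.m+[n∸m]≡n N≤m)

  -- Beyond the agreed window every letter is copied from one period earlier.
  Periodic-≐ : ∀ {α β : Str σ} {N} p → Periodic α N (suc p) → Periodic β N (suc p) →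
               Agree α β (N + suc p) → α ≐ β
  Periodic-≐ {α} {β} {N} p perα perβ ag = <-rec (λ i → α i ≡ β i) step
    where
    step : ∀ i → (∀ {j} → j < i → α j ≡ β j) → α i ≡ β i
    step i rec with i ℕ.<? N + suc p
    ... | yes i<B = ag i i<B
    ... | no i≮B = begin
      α i            ≡⟨ cong α j+q≡i ⟨
      α (j + suc p)  ≡⟨ perα j N≤j ⟩
      α j            ≡⟨ rec j<i ⟩
      β j            ≡⟨ perβ j N≤j ⟨
      β (j + suc p)  ≡⟨ cong β j+q≡i ⟩
      β i            ∎
      where
      open ≡-Reasoning
      B≤i : N + suc p ≤ i
      B≤i = ℕ.≮⇒≥ i≮B
      j : ℕ
      j = i ∸ suc p
      j+q≡i : j + suc p ≡ i
      j+q≡i = ℕ.m∸n+n≡m (ℕ.≤-trans (ℕ.m≤n+m (suc p) N) B≤i)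
      N≤j : N ≤ j
      N≤j = ℕ.+-cancelʳ-≤ (suc p) N j (subst (N + suc p ≤_) (sym j+q≡i) B≤i)
      j<i : j < i
      j<i = subst (j <_) j+q≡i (ℕ.m<m+n j (s≤s z≤n))

  compare-upTo : ∀ K (α β : Str σ) → α ≺ β ⊎ Agree α β K ⊎ β ≺ α
  compare-upTo zero α β = inj₂ (inj₁ (λ _ ()))
  compare-upTo (suc K) α β with compare-upTo K α β
  ... | inj₁ α≺β = inj₁ α≺β
  ... | inj₂ (inj₂ β≺α) = inj₂ (inj₂ β≺α)
  ... | inj₂ (inj₁ ag) with FP.<-cmp (α K) (β K)
  ...   | tri< lt _ _ = inj₁ (K , ag , lt)
  ...   | tri> _ _ gt = inj₂ (inj₂ (K , (λ i i<K → sym (ag i i<K)) , gt))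
  ...   | tri≈ _ eq _ = inj₂ (inj₁ agree)
    where
    agree : Agree α β (suc K)
    agree i i<K with ℕ.m≤n⇒m<n∨m≡n (ℕ.≤-pred i<K)
    ... | inj₁ i<K′ = ag i i<K′
    ... | inj₂ refl = eq

  Periodic-trichotomy : ∀ {α β : Str σ} {N} p → Periodic α N (suc p) → Periodic β N (suc p) →
                        α ≺ β ⊎ α ≐ β ⊎ β ≺ α
  Periodic-trichotomy {α} {β} {N} p perα perβ with compare-upTo (N + suc p) α β
  ... | inj₁ α≺β = inj₁ α≺β
  ... | inj₂ (inj₁ ag) = inj₂ (inj₁ (Periodic-≐ p perα perβ ag))
  ... | inj₂ (inj₂ β≺α) = inj₂ (inj₂ β≺α)

  Periodic⇒τ-trichotomy : ∀ {α : Str σ} {N} p → Periodic α N (suc p) → τ α 1 ⊎ τ α 2 ⊎ τ α 3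
  Periodic⇒τ-trichotomy p per = Periodic-trichotomy p (Periodic-tail per) per

  Agree⇒pre-≡ : ∀ {α β : Str σ} k → Agree α β k → pre α k ≡ pre β k
  Agree⇒pre-≡ zero _ = refl
  Agree⇒pre-≡ (suc k) ag = cong₂ _∷_ (ag 0 (s≤s z≤n)) (Agree⇒pre-≡ k (Agree-tail ag))

  Prefix-pre⇒ : ∀ {α β : Str σ} m n → Prefix _≡_ (pre α m) (pre β n) → m ≤ n × Agree α β m
  Prefix-pre⇒ zero n _ = z≤n , λ _ ()
  Prefix-pre⇒ (suc m) (suc n) (e ∷ p) with Prefix-pre⇒ m n p
  ... | m≤n , ag = s≤s m≤n , Agree-cons e ag

  pre-≡⇒ : ∀ {α β : Str σ} m n → pre α m ≡ pre β n → m ≡ n × Agree α β m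
  pre-≡⇒ m n e with Prefix-pre⇒ m n (fromPointwise (≡⇒Pointwise-≡ e))
                  | Prefix-pre⇒ n m (fromPointwise (≡⇒Pointwise-≡ (sym e)))
  ... | m≤n , ag | n≤m , _ = ℕ.≤-antisym m≤n n≤m , ag

  LexBefore : List (Fin σ) → List (Fin σ) → Set
  LexBefore xs ys = ¬ Prefix _≡_ xs ys × Lex-< _≡_ F._<_ xs ys

  ProperPrefix : List (Fin σ) → List (Fin σ) → Set
  ProperPrefix xs ys = Prefix _≡_ xs ys × xs ≢ ys

  ProperPrefix-pre⇒ : ∀ {α β : Str σ} m n → ProperPrefix (pre α m) (pre β n) → m < n × Agree α β m
  ProperPrefix-pre⇒ m n (p , ne) with Prefix-pre⇒ m n p
  ... | m≤n , ag = ℕ.≤∧≢⇒< m≤n (λ { refl → ne (Agree⇒pre-≡ m ag) }) , ag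

  LexBefore-pre⇒≺ : ∀ {α β : Str σ} m n → LexBefore (pre α m) (pre β n) → α ≺ β
  LexBefore-pre⇒≺ zero _ (np , _) = contradiction [] np
  LexBefore-pre⇒≺ (suc m) (suc n) (_ , this lt) = 0 , (λ _ ()) , lt
  LexBefore-pre⇒≺ (suc m) (suc n) (np , next e lex) =
    ≺-tail⁻ e (LexBefore-pre⇒≺ m n (np ∘ (e ∷_) , lex))

  Falling : Str σ → ℕ → Set
  Falling α L = ∀ i → 1 ≤ i → i < L → τ (drop i α) 1

  -- Descent α L says that L + 1 is the paper's ℓ for the string α.
  record Descent (α : Str σ) (L : ℕ) : Set where
    field
      positive : 1 ≤ L
      falling  : Falling α L
      stops    : ∃ λ t → 1 < t × τ (drop L α) t

  Falling-step : ∀ {α : Str σ} {L i} → Falling α L → 1 ≤ i → i < L → drop (suc i) α ≺ drop i α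
  Falling-step {α} {i = i} fall 1≤i i<L = ≺-resp-≐ (tail-drop i α) ≐-refl (fall i 1≤i i<L)

  Falling⇒≺ : ∀ {α : Str σ} {L} → Falling α L →
              ∀ j k → 1 ≤ j → j ≤ k → k < L → drop (suc k) α ≺ drop j α
  Falling⇒≺ _ zero zero () _ _
  Falling⇒≺ {α} fall j (suc k) 1≤j j≤k k<L with ℕ.m≤n⇒m<n∨m≡n j≤k
  ... | inj₂ refl = Falling-step {α} fall 1≤j k<L
  ... | inj₁ j<k = ≺-trans (Falling-step {α} fall (s≤s z≤n) k<L)
                           (Falling⇒≺ {α} fall j k 1≤j (ℕ.≤-pred j<k) (ℕ.<-trans (ℕ.n<1+n k) k<L))

  same-γ⇒≺ : ∀ {α β : Str σ} {Lα Lβ t t′} → pre α (suc Lα) ≡ pre β (suc Lβ) →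
             τ (drop Lα α) t → τ (drop Lβ β) t′ → t < t′ → α ≺ β
  same-γ⇒≺ {Lα = L} {Lβ} e p q t<t′ with pre-≡⇒ (suc L) (suc Lβ) e
  ... | refl , ag = ≺-by-τ-at L ag p q t<t′

  same-γ⇒τ≤ : ∀ {α β : Str σ} {Lα Lβ t t′} → α ≼ β → pre α (suc Lα) ≡ pre β (suc Lβ) →
              τ (drop Lα α) t → τ (drop Lβ β) t′ → t ≤ t′
  same-γ⇒τ≤ {Lα = L} {Lβ} le e p q with pre-≡⇒ (suc L) (suc Lβ) e
  ... | refl , ag = τ-at-mono L le ag p q

  shorter-γ⇒≺ : ∀ {α β : Str σ} {Lα Lβ} → Falling α Lα → Descent β Lβ →
                ProperPrefix (pre β (suc Lβ)) (pre α (suc Lα)) → α ≺ β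
  shorter-γ⇒≺ {Lα = Lα} {Lβ} fall dβ pp with ProperPrefix-pre⇒ (suc Lβ) (suc Lα) pp | Descent.stops dβ
  ... | s≤s Lβ<Lα , ag | t , 1<t , q =
    ≺-by-τ-at Lβ (λ i i<L → sym (ag i i<L)) (fall Lβ (Descent.positive dβ) Lβ<Lα) q 1<t

  Before : List (Fin σ) → List (Fin σ) → ℕ → ℕ → Set
  Before γα γβ tα tβ = LexBefore γα γβ ⊎ (γα ≡ γβ × tα ≡ 2 × tβ ≡ 3) ⊎ ProperPrefix γβ γα

  NotAfter : List (Fin σ) → List (Fin σ) → ℕ → ℕ → Set
  NotAfter γα γβ tα tβ = LexBefore γα γβ ⊎ (γα ≡ γβ × tα ≤ tβ) ⊎ ProperPrefix γβ γα

  Before⇒≺ : ∀ {α β : Str σ} {Lα Lβ tα tβ} → Descent α Lα → Descent β Lβ →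
             τ (drop Lα α) tα → τ (drop Lβ β) tβ →
             Before (pre α (suc Lα)) (pre β (suc Lβ)) tα tβ → α ≺ β
  Before⇒≺ _ _ _ _ (inj₁ lex) = LexBefore-pre⇒≺ _ _ lex
  Before⇒≺ _ _ pα pβ (inj₂ (inj₁ (e , refl , refl))) = same-γ⇒≺ e pα pβ ℕ.≤-refl
  Before⇒≺ dα dβ _ _ (inj₂ (inj₂ pp)) = shorter-γ⇒≺ (Descent.falling dα) dβ pp

  ≼⇒NotAfter : ∀ {α β : Str σ} {Lα Lβ tα tβ} → Descent α Lα → Descent β Lβ →
               τ (drop Lα α) tα → τ (drop Lβ β) tβ →
               α ≼ β → NotAfter (pre α (suc Lα)) (pre β (suc Lβ)) tα tβ
  ≼⇒NotAfter {α} {β} {Lα} {Lβ} dα dβ pα pβ le with <-compare sym FP.<-cmp (pre α (suc Lα)) (pre β (suc Lβ))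
  ... | tri< γα<γβ γα≉γβ _ with prefix? FP._≟_ (pre α (suc Lα)) (pre β (suc Lβ))
  ...   | no γα⋢γβ = inj₁ (γα⋢γβ , γα<γβ)
  ...   | yes γα⊑γβ = contradiction le
          (≺⇒⋡ (shorter-γ⇒≺ (Descent.falling dβ) dα (γα⊑γβ , γα≉γβ ∘ ≡⇒Pointwise-≡)))
  ≼⇒NotAfter dα dβ pα pβ le | tri≈ _ γα≋γβ _ =
    inj₂ (inj₁ (Pointwise-≡⇒≡ γα≋γβ , same-γ⇒τ≤ le (Pointwise-≡⇒≡ γα≋γβ) pα pβ))
  ≼⇒NotAfter {α} {β} {Lα} {Lβ} dα dβ pα pβ le | tri> _ γα≉γβ γβ<γα
    with prefix? FP._≟_ (pre β (suc Lβ)) (pre α (suc Lα))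
  ...   | yes γβ⊑γα = inj₂ (inj₂ (γβ⊑γα , γα≉γβ ∘ ≡⇒Pointwise-≡ ∘ sym))
  ...   | no γβ⋢γα = contradiction le (≺⇒⋡ (LexBefore-pre⇒≺ (suc Lβ) (suc Lα) (γβ⋢γα , γβ<γα)))

_∷ₛ_ : ∀ {A : Set} → A → (ℕ → A) → ℕ → A
(a ∷ₛ s) zero = a
(a ∷ₛ s) (suc i) = s i

module _ {σ n} (G : Graph σ n) (mn : Fin n → Str σ) (mins : ∀ w → IsMin G w (mn w)) where

  Occ-∷ : ∀ {α w ws y} → Occ G α w ws → E G w y ≡ true → Occ G (lab G y ∷ₛ α) y (y ∷ₛ ws)
  Occ-∷ {α} {w} {ws} {y} (ws₀ , edges , labels) e = refl , edges′ , labels′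
    where
    edges′ : ∀ i → E G ((y ∷ₛ ws) (suc i)) ((y ∷ₛ ws) i) ≡ true
    edges′ zero = subst (λ x → E G x y ≡ true) (sym ws₀) e
    edges′ (suc i) = edges i
    labels′ : ∀ i → lab G ((y ∷ₛ ws) i) ≡ (lab G y ∷ₛ α) i
    labels′ zero = refl
    labels′ (suc i) = labels i

  Occ-tail : ∀ {α w ws} → Occ G α w ws → Occ G (tail α) (ws 1) (tail ws)
  Occ-tail (_ , edges , labels) = refl , edges ∘ suc , labels ∘ suc

  Occ-resp-≐ : ∀ {α β w ws} → α ≐ β → Occ G α w ws → Occ G β w ws
  Occ-resp-≐ p (ws₀ , edges , labels) = ws₀ , edges , λ i → trans (labels i) (p i)

  Occ-head : ∀ {α w ws} → Occ G α w ws → α 0 ≡ lab G w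
  Occ-head (ws₀ , _ , labels) = trans (sym (labels 0)) (cong (lab G) ws₀)

  min-≼ : ∀ {α w ws} → Occ G α w ws → mn w ≼ α
  min-≼ {α} {w} {ws} = proj₂ (mins w) α ws

  min-head : ∀ w → mn w 0 ≡ lab G w
  min-head w = Occ-head (proj₂ (proj₁ (mins w)))

  -- Prepending the edge (ws 1, w) to an occurrence of min_{ws 1} gives an occurrence at w.
  min-tail : ∀ {w ws} → Occ G (mn w) w ws → mn (ws 1) ≐ tail (mn w)
  min-tail {w} {ws} occ@(ws₀ , edges , _) = ≼-antisym (min-≼ (Occ-tail occ)) tail≼
    where
    edge : E G (ws 1) w ≡ true
    edge = subst (λ x → E G (ws 1) x ≡ true) ws₀ (edges 0)
    tail≼ : tail (mn w) ≼ mn (ws 1)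
    tail≼ = ≼-tail (min-≼ (Occ-∷ (proj₂ (proj₁ (mins (ws 1)))) edge)) (Occ-head occ)

  min-drop : ∀ {w ws} → Occ G (mn w) w ws → ∀ k → mn (ws k) ≐ drop k (mn w)
  min-drop (ws₀ , _) zero i = cong (λ x → mn x i) ws₀
  min-drop {w} {ws} occ (suc k) i =
    trans (min-drop (Occ-resp-≐ (≐-sym (min-tail occ)) (Occ-tail occ)) k i) (min-tail occ (k + i))

  -- An occurrence of min_w visits some node twice among its first n + 1 positions.
  min-periodic : ∀ w → ∃₂ λ N p → Periodic (mn w) N (suc p)
  min-periodic w = periodic (FP.pigeonhole (ℕ.n<1+n n) (ws ∘ F.toℕ))
    where
    ws : ℕ → Fin n
    ws = proj₁ (proj₁ (mins w))
    occ : Occ G (mn w) w ws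
    occ = proj₂ (proj₁ (mins w))
    periodic : (∃₂ λ i j → i F.< j × ws (F.toℕ i) ≡ ws (F.toℕ j)) → ∃₂ λ N p → Periodic (mn w) N (suc p)
    periodic (i , j , i<j , wsᵢ≡wsⱼ) = F.toℕ i , p , drop-≐⇒Periodic (F.toℕ i) (suc p) repeat
      where
      p : ℕ
      p = F.toℕ j ∸ suc (F.toℕ i)
      j≡i+1+p : F.toℕ j ≡ F.toℕ i + suc p
      j≡i+1+p = sym (trans (ℕ.+-suc (F.toℕ i) p) (ℕ.m+[n∸m]≡n i<j))
      repeat : drop (F.toℕ i) (mn w) ≐ drop (F.toℕ i + suc p) (mn w)
      repeat = ≐-trans (≐-sym (min-drop occ (F.toℕ i)))
                 (≐-trans (λ k → cong (λ x → mn x k) wsᵢ≡wsⱼ)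
                   (≐-trans (min-drop occ (F.toℕ j)) (λ k → cong (λ m → mn w (m + k)) j≡i+1+p)))

  τ-min-trichotomy : ∀ w → τN G mn w 1 ⊎ τN G mn w 2 ⊎ τN G mn w 3
  τ-min-trichotomy w with min-periodic w
  ... | _ , p , per = Periodic⇒τ-trichotomy p per

  τ-min-defined : ∀ w → ∃ λ t → τN G mn w t
  τ-min-defined w with τ-min-trichotomy w
  ... | inj₁ p = 1 , p
  ... | inj₂ (inj₁ p) = 2 , p
  ... | inj₂ (inj₂ p) = 3 , p

  module Stages {u us} (occ : Occ G (mn u) u us) {L} (fall : Falling (mn u) L) where

    Union : ℕ → Fin n → Set
    Union k = proj₂ (H G mn u k)

    record Stage (k : ℕ) : Set where
      field
        on-path : Gset G mn u (suc k) (us k)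
        members : ∀ y → Gset G mn u (suc k) y → drop k (mn u) ≼ mn y × lab G y ≡ drop k (mn u) 0
        earlier : ∀ y → Union (suc k) y → ∃ λ j → 1 ≤ j × j ≤ k × drop j (mn u) ≼ mn y

    stage-zero : Stage 0
    stage-zero = record { on-path = proj₁ occ ; members = members ; earlier = λ _ () }
      where
      members : ∀ y → y ≡ u → mn u ≼ mn y × lab G y ≡ mn u 0
      members _ refl = inj₂ ≐-refl , sym (Occ-head occ)

    module Step {k} (k<L : k < L) (s : Stage k) where
      open Stage s

      α : Str σ
      α = mn u
      succ : Fin n
      succ = us (suc k)
      R : Fin n → Set
      R = Preds G mn (Gset G mn u (suc k))

      pred-≽ : ∀ w → R w → drop (suc k) α ≼ mn w
      pred-≽ w (y , y∈G , edge) with members y y∈G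
      ... | α≼y , lab≡ = ≼-trans (inj₂ (≐-sym (tail-drop k α)))
                           (≼-tail (≼-trans α≼y (min-≼ (Occ-∷ (proj₂ (proj₁ (mins w))) edge))) (sym lab≡))

      lab-≥ : ∀ w → R w → drop (suc k) α 0 F.≤ lab G w
      lab-≥ w rw = subst (drop (suc k) α 0 F.≤_) (min-head w) (≼⇒head-≤ (pred-≽ w rw))

      succ∈R : R succ
      succ∈R = us k , on-path , proj₁ (proj₂ occ) k

      lab-succ : lab G succ ≡ drop (suc k) α 0
      lab-succ = trans (proj₂ (proj₂ occ) (suc k)) (sym (drop-head (suc k) α))

      succ-argmin : ArgMinλ G mn R succ
      succ-argmin = succ∈R , λ w rw → subst (F._≤ lab G w) (sym lab-succ) (lab-≥ w rw)

      succ-τ-least : ∀ t → τN G mn succ t → ∀ w t′ → ArgMinλ G mn R w → τN G mn w t′ → t ≤ t′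
      succ-τ-least t p w t′ (rw , least) q =
        τ-mono (≼-trans (inj₂ (min-drop occ (suc k))) (pred-≽ w rw)) heads p q
        where
        heads : mn succ 0 ≡ mn w 0
        heads = trans (min-head succ)
                  (trans (FP.≤-antisym (proj₂ succ-argmin w rw) (least succ succ∈R)) (sym (min-head w)))

      succ∉Union : ¬ Union (suc k) succ
      succ∉Union x with earlier succ x
      ... | j , 1≤j , j≤k , le =
        ≺⇒⋡ (Falling⇒≺ {α = α} fall j k 1≤j j≤k k<L) (≼-trans le (inj₂ (min-drop occ (suc k))))

      succ-stage : Stage (suc k)
      succ-stage = record { on-path = on-path′ ; members = members′ ; earlier = earlier′ }
        where
        on-path′ : Gset G mn u (suc (suc k)) succ
        on-path′ with τ-min-defined succ
        ... | t , p = (succ-argmin , t , p , succ-τ-least t p) , succ∉Union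
        members′ : ∀ y → Gset G mn u (suc (suc k)) y → drop (suc k) α ≼ mn y × lab G y ≡ drop (suc k) α 0
        members′ y (((ry , least) , _) , _) =
          pred-≽ y ry , FP.≤-antisym (subst (lab G y F.≤_) lab-succ (least succ succ∈R)) (lab-≥ y ry)
        earlier′ : ∀ y → Union (suc (suc k)) y → ∃ λ j → 1 ≤ j × j ≤ suc k × drop j α ≼ mn y
        earlier′ y (inj₁ x) with earlier y x
        ... | j , 1≤j , j≤k , le = j , 1≤j , ℕ.m≤n⇒m≤1+n j≤k , le
        earlier′ y (inj₂ y∈G) = suc k , s≤s z≤n , ℕ.≤-refl , proj₁ (members′ y y∈G)

    stage : ∀ k → k ≤ L → Stage k
    stage zero _ = stage-zero
    stage (suc k) k<L = Step.succ-stage k<L (stage k (ℕ.<⇒≤ k<L))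

  IsEll⇒Falling : ∀ {u L} → IsEll G mn u (suc L) → Falling (mn u) L
  IsEll⇒Falling (us , occ , _ , _ , not≥2) i 1≤i i<L with τ-min-trichotomy (us i)
  ... | inj₁ p = τ-resp-≐ 1 (min-drop occ i) p
  ... | inj₂ p≥2 = contradiction p≥2 (not≥2 (suc i) (s≤s 1≤i) (s≤s i<L))

  IsEll⇒Descent : ∀ {u ℓ} → IsEll G mn u ℓ → ∃ λ L → ℓ ≡ suc L × Descent (mn u) L
  IsEll⇒Descent {u} ell@(us , occ , s≤s 1≤L , top , _) =
    _ , refl , record { positive = 1≤L ; falling = IsEll⇒Falling ell ; stops = stops top }
    where
    stops : ∀ {L} → τ≥2 G mn (us L) → ∃ λ t → 1 < t × τ (drop L (mn u)) t
    stops (inj₁ p) = 2 , ℕ.≤-refl , τ-resp-≐ 2 (min-drop occ _) p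
    stops (inj₂ p) = 3 , s≤s (s≤s z≤n) , τ-resp-≐ 3 (min-drop occ _) p

  IsT⇒τ : ∀ {u L t} → IsEll G mn u (suc L) → IsT G mn u (suc L) t → τ (drop L (mn u)) t
  IsT⇒τ {L = L} {t} ell@(us , occ , _) (_ , τ-on-G) =
    τ-resp-≐ t (min-drop occ L) (τ-on-G (us L) (Stage.on-path (stage L ℕ.≤-refl)))
    where open Stages occ (IsEll⇒Falling ell)

lemma17 : ∀ {σ n} (G : Graph σ n) → EveryNodeHasIncoming G → Deterministic G →
    (mn : Fin n → (ℕ → Fin σ)) → (∀ w → IsMin G w (mn w)) →
    ∀ u v → τN G mn u 3 → τN G mn v 3 →
    ∀ ℓu ℓv → IsEll G mn u ℓu → IsEll G mn v ℓv →
    ∀ tu tv → IsT G mn u ℓu tu → IsT G mn v ℓv tv →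
    ((((¬ Prefix _≡_ (pre (mn u) ℓu) (pre (mn v) ℓv))
         × Lex-< _≡_ F._<_ (pre (mn u) ℓu) (pre (mn v) ℓv))
      ⊎ ((pre (mn u) ℓu ≡ pre (mn v) ℓv) × (tu ≡ 2) × (tv ≡ 3))
      ⊎ (Prefix _≡_ (pre (mn v) ℓv) (pre (mn u) ℓu)
         × (pre (mn v) ℓv ≢ pre (mn u) ℓu)))
     → mn u ≺ mn v)
    × (mn u ≼ mn v →
       ((¬ Prefix _≡_ (pre (mn u) ℓu) (pre (mn v) ℓv))
         × Lex-< _≡_ F._<_ (pre (mn u) ℓu) (pre (mn v) ℓv))
       ⊎ ((pre (mn u) ℓu ≡ pre (mn v) ℓv) × (tu ≤ tv))
       ⊎ (Prefix _≡_ (pre (mn v) ℓv) (pre (mn u) ℓu)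
          × (pre (mn v) ℓv ≢ pre (mn u) ℓu)))
lemma17 G _ _ mn mins u v _ _ ℓu ℓv ellu ellv tu tv Tu Tv
  with IsEll⇒Descent G mn mins ellu | IsEll⇒Descent G mn mins ellv
... | Lu , refl , du | Lv , refl , dv = Before⇒≺ du dv pu pv , ≼⇒NotAfter du dv pu pv
  where
  pu : τ (drop Lu (mn u)) tu
  pu = IsT⇒τ G mn mins ellu Tu
  pv : τ (drop Lv (mn v)) tv
  pv = IsT⇒τ G mn mins ellv Tv
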